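{- Let $k\ge 2$ and $q\ge 1$ be integers, and let $m_{k,q}$ be the minimum, over all Sperner labelings of the vertex set $\Delta_{k,q}\cap\mathbb{Z}^k$, of the number of non-monochromatic simplices of the regular triangulation $\mathcal{T}$ of $\Delta_{k,q}$. Then \[ m_{k,q}\ \le\ q^{k-1}-(q-1)^{k-1}. \]
   Context: $\Delta_{k,q}=\mathrm{Conv}\{(q,0,\dots,0),\dots,(0,\dots,0,q)\}=\{x\in\mathbb{R}^k: x_i\ge 0,\ \sum_i x_i=q\}$, with lattice points $\Delta_{k,q}\cap\mathbb{Z}^k$. Let $R_{k,q}=\{y\in\mathbb{R}^{k-1}: 0\le y_1\le y_2\le\dots\le y_{k-1}\le q\}$ and $W_{k,q}=R_{k,q}\cap\mathbb{Z}^{k-1}$. A permutation $\pi$ of $\{1,\dots,k-1\}$ is consistent with $w\in W_{k,q}$ if $w_i=w_{i+1}$ implies $\pi(i)<\pi(i+1)$. For such $(w,\pi)$ let $\sigma(w,\pi)=\{y\in\mathbb{R}^{k-1}: y_i\ge 0 \text{ for all } i,\ 0\le (y-w)_{\pi(1)}\le\dots\le (y-w)_{\pi(k-1)}\le 1\}$. Let $\phi:R_{k,q}\to\Delta_{k,q}$, $\phi(y_1,\dots,y_{k-1})=(y_1,y_2-y_1,\dots,y_{k-1}-y_{k-2},q-y_{k-1})$. The regular triangulation is $\mathcal{T}=\{\phi(\sigma(w,\pi)) : w\in W_{k,q},\ \pi \text{ consistent with } w\}$; its vertices are the points of $\Delta_{k,q}\cap\mathbb{Z}^k$. A Sperner labeling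 is a map $c:\Delta_{k,q}\cap\mathbb{Z}^k\to\{1,\dots,k\}$ such that $v_i=0$ implies $c(v)\ne i$. A simplex of $\mathcal{T}$ is monochromatic if all its vertices receive the same label, and non-monochromatic otherwise. -}

module Defs where

open import Data.Nat using (ℕ; zero; suc; _+_; _∸_; _≤_)
open import Data.Fin as Fin using (Fin; toℕ)
open import Data.Vec using (Vec; []; _∷_; lookup; tabulate; toList; sum)
open import Data.List using (List; drop)
import Data.List.Membership.DecPropositional as DecMem
open import Data.Vec.Relation.Unary.Unique.Propositional using (Unique)
open import Data.Product using (_×_; Σ; _,_)
open import Relation.Nullary using (¬_; does)
open import Relation.Binary.PropositionalEquality using (_≡_; _≢_)
open import Data.Bool using (if_then_else_)

-- Conventions: k is the ambient dimension, n = k ∸ 1.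
-- Points of ℤ^k are Vec ℕ k, points of ℤ^(k-1) are Vec ℕ (k ∸ 1).
-- Labels {1,…,k} are represented by Fin k (label i+1 ↔ Fin index i);
-- coordinates are 0-indexed.

InΔ : (k q : ℕ) → Vec ℕ k → Set
InΔ k q v = sum v ≡ q

-- A labeling (only its values on Δ_{k,q} ∩ ℤ^k matter).
Labeling : ℕ → Set
Labeling k = Vec ℕ k → Fin k

Sperner : (k q : ℕ) → Labeling k → Set
Sperner k q c = ∀ (v : Vec ℕ k) → InΔ k q v → ∀ (i : Fin k) → lookup v i ≡ 0 → c v ≢ i

-- Membership in R_{k,q}: 0 ≤ y_1 ≤ … ≤ y_{k-1} ≤ q (nonnegativity is automatic in ℕ).
InR : ∀ {n} → ℕ → Vec ℕ n → Set
InR {n} q y = (∀ (i j : Fin n) → toℕ i ≤ toℕ j → lookup y i ≤ lookup y j)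
            × (∀ (i : Fin n) → lookup y i ≤ q)

look : ∀ {n} → ℕ → Vec ℕ n → ℕ → ℕ
look q []      m       = q
look q (x ∷ y) zero    = x
look q (x ∷ y) (suc m) = look q y m

-- ŷ with ŷ(0) = 0, ŷ(m) = y_m, ŷ(k) = q.
ext : ∀ {n} → ℕ → Vec ℕ n → ℕ → ℕ
ext q y zero    = 0
ext q y (suc m) = look q y m

φ : (k q : ℕ) → Vec ℕ (k ∸ 1) → Vec ℕ k
φ k q y = tabulate (λ (i : Fin k) → ext q y (suc (toℕ i)) ∸ ext q y (toℕ i))

Cell : ℕ → Set
Cell k = Vec ℕ (k ∸ 1) × Vec (Fin (k ∸ 1)) (k ∸ 1)

-- The j-th vertex (j = 0,…,n) of σ(w,π) = {y : 0 ≤ (y-w)_{π(1)} ≤ … ≤ (y-w)_{π(n)} ≤ 1}: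
-- w + e_{π(n-j+1)} + … + e_{π(n)}.
vertex : ∀ {n} → Vec ℕ n → Vec (Fin n) n → Fin (suc n) → Vec ℕ n
vertex {n} w π j =
  tabulate (λ c → lookup w c + (if does (DecMem._∈?_ (Fin._≟_ {n}) c (drop (n ∸ toℕ j) (toList π))) then 1 else 0))

-- (w, π) indexes a simplex φ(σ(w,π)) of the triangulation 𝒯 of Δ_{k,q}:
-- π is a permutation and σ(w,π) ⊆ R_{k,q} (equivalently, all its vertices lie in R_{k,q};
-- vertex 0 is w, so this includes w ∈ W_{k,q}).
IsSimplex : (k q : ℕ) → Cell k → Set
IsSimplex k q (w , π) = Unique π × (∀ (j : Fin k') → InR q (vertex w π j))
  where k' = suc (k ∸ 1)

simplexVertex : (k q : ℕ) → Cell k → Fin (suc (k ∸ 1)) → Vec ℕ k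
simplexVertex k q (w , π) j = φ k q (vertex w π j)

Monochromatic : (k q : ℕ) → Labeling k → Cell k → Set
Monochromatic k q c s =
  ∀ (j j' : Fin (suc (k ∸ 1))) → c (simplexVertex k q s j) ≡ c (simplexVertex k q s j')

-- Label each lattice point by its first nonzero coordinate; this is a Sperner
-- labeling. A simplex φ(σ(w,π)) with w₁ > 0 has all its vertices in the open
-- half-space y₁ > 0, so all of them get label 1: only cells with w₁ = 0 can be
-- non-monochromatic. Deleting the coordinate π(n+1) of a simplex cell (w,π) of
-- dimension n+1 yields a simplex cell of dimension n together with the deleted
-- value w_{π(n+1)} < q, and the cell is recovered from this pair. Hence the
-- simplex cells of dimension n are among q ^ n candidates, and those with
-- w₁ = 0 among a_n candidates, where a₀ = 0 and a_{n+1} = q ^ n + (q - 1) a_n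
-- (either the deleted value is 0, or it is positive and the smaller cell still
-- has w₁ = 0). So a_n = q ^ n - (q - 1) ^ n.
module Submission where

open import Defs
open import Data.Nat using (ℕ; _≤_; _^_; _∸_)
open import Data.List using (List; length)
open import Data.List.Membership.Propositional using (_∈_)
open import Data.Product using (Σ; _×_)
open import Relation.Nullary using (¬_)

open import Data.Nat using (zero; suc; _+_; _*_; _<_; z≤n; s≤s; _≤?_)
import Data.Nat.Properties as ℕₚ
open import Data.Fin as Fin using (Fin; toℕ; punchIn; punchOut)
import Data.Fin.Properties as Finₚ
open import Data.Vec using (Vec; []; _∷_; lookup; toList; insertAt; removeAt; _∷ʳ_; initLast)
import Data.Vec as Vec
import Data.Vec.Properties as Vecₚ
open import Data.Vec.Relation.Unary.All using (All; []; _∷_)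
open import Data.Vec.Relation.Unary.AllPairs using ([]; _∷_)
open import Data.Vec.Relation.Unary.Unique.Propositional using (Unique)
open import Data.List using ([]; _∷_; [_]; _++_; drop; upTo; cartesianProductWith)
import Data.List as List
import Data.List.Properties as Listₚ
import Data.List.Membership.Propositional.Properties as ∈ₚ
import Data.List.Membership.DecPropositional as DecMembership
open import Data.List.Relation.Unary.Any using (here)
open import Data.Product using (_,_; proj₁; proj₂)
open import Data.Sum using (_⊎_; inj₁; inj₂)
open import Data.Empty using (⊥; ⊥-elim)
open import Data.Bool using (if_then_else_)
open import Relation.Nullary using (Dec; yes; no; does; contradiction)
open import Relation.Binary.PropositionalEquality using (_≡_; _≢_; refl; sym; trans; cong; cong₂; subst; subst₂; module ≡-Reasoning)
open import Function using (_∘_)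

indicator : {P : Set} → Dec P → ℕ
indicator d = if does d then 1 else 0

indicator-yes : {P : Set} (d : Dec P) → P → indicator d ≡ 1
indicator-yes (yes _) _ = refl
indicator-yes (no ¬p) p = contradiction p ¬p

indicator-no : {P : Set} (d : Dec P) → ¬ P → indicator d ≡ 0
indicator-no (yes p) ¬p = contradiction p ¬p
indicator-no (no _)  _  = refl

indicator-cong : {P Q : Set} (a : Dec P) (b : Dec Q) → (P → Q) → (Q → P) → indicator a ≡ indicator b
indicator-cong a (yes q) _ g = indicator-yes a (g q)
indicator-cong a (no ¬q) f _ = indicator-no a (¬q ∘ f)

_∈?_ : ∀ {n} (c : Fin n) (cs : List (Fin n)) → Dec (c ∈ cs)
_∈?_ {n} = DecMembership._∈?_ (Fin._≟_ {n})

length-cartesianProductWith : {A B C : Set} (f : A → B → C) (xs : List A) (ys : List B) →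
  length (cartesianProductWith f xs ys) ≡ length xs * length ys
length-cartesianProductWith f []       ys = refl
length-cartesianProductWith f (x ∷ xs) ys = begin
  length (List.map (f x) ys ++ cartesianProductWith f xs ys)
    ≡⟨ Listₚ.length-++ (List.map (f x) ys) ⟩
  length (List.map (f x) ys) + length (cartesianProductWith f xs ys)
    ≡⟨ cong₂ _+_ (Listₚ.length-map (f x) ys) (length-cartesianProductWith f xs ys) ⟩
  length ys + length xs * length ys ∎
  where open ≡-Reasoning

drop-toList : {A : Set} {n : ℕ} (xs : Vec A n) → drop n (toList xs) ≡ []
drop-toList []       = refl
drop-toList (x ∷ xs) = drop-toList xs

drop-toList-map-∷ʳ : {A B : Set} {n : ℕ} (f : A → B) (y : B) (xs : Vec A n) (m : ℕ) → m ≤ n →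
  drop m (toList (Vec.map f xs ∷ʳ y)) ≡ List.map f (drop m (toList xs)) ++ [ y ]
drop-toList-map-∷ʳ f y xs zero _ =
  trans (Vecₚ.toList-∷ʳ y (Vec.map f xs)) (cong (_++ [ y ]) (Vecₚ.toList-map f xs))
drop-toList-map-∷ʳ f y (x ∷ xs) (suc m) (s≤s m≤n) = drop-toList-map-∷ʳ f y xs m m≤n

Unique-map⁻ : {A B : Set} {n : ℕ} (f : A → B) (xs : Vec A n) → Unique (Vec.map f xs) → Unique xs
Unique-map⁻ f []       []          = []
Unique-map⁻ f (x ∷ xs) (fx∉ ∷ fxs!) = distinct xs fx∉ ∷ Unique-map⁻ f xs fxs!
  where
  distinct : ∀ {m} (ys : Vec _ m) → All (f x ≢_) (Vec.map f ys) → All (x ≢_) ys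
  distinct []       []          = []
  distinct (y ∷ ys) (fx≢fy ∷ ne) = (fx≢fy ∘ cong f) ∷ distinct ys ne

All-∷ʳ⁻ : {A : Set} {P : A → Set} {n : ℕ} (xs : Vec A n) (y : A) → All P (xs ∷ʳ y) → All P xs × P y
All-∷ʳ⁻ []       y (py ∷ []) = [] , py
All-∷ʳ⁻ (x ∷ xs) y (px ∷ ps) with All-∷ʳ⁻ xs y ps
... | pxs , py = (px ∷ pxs) , py

Unique-∷ʳ⁻ : {A : Set} {n : ℕ} (xs : Vec A n) (y : A) → Unique (xs ∷ʳ y) → Unique xs × All (_≢ y) xs
Unique-∷ʳ⁻ []       y _           = [] , []
Unique-∷ʳ⁻ (x ∷ xs) y (x∉ ∷ xsy!) with All-∷ʳ⁻ xs y x∉ | Unique-∷ʳ⁻ xs y xsy!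
... | x∉xs , x≢y | xs! , xs≢y = (x∉xs ∷ xs!) , (x≢y ∷ xs≢y)

All≢⇒map-punchIn : ∀ {m n} (p : Fin (suc m)) (xs : Vec (Fin (suc m)) n) → All (_≢ p) xs →
  Σ (Vec (Fin m) n) λ ys → xs ≡ Vec.map (punchIn p) ys
All≢⇒map-punchIn p []       []            = [] , refl
All≢⇒map-punchIn p (x ∷ xs) (x≢p ∷ xs≢p) with All≢⇒map-punchIn p xs xs≢p
... | ys , refl = (punchOut (x≢p ∘ sym) ∷ ys) , cong (_∷ _) (sym (Finₚ.punchIn-punchOut (x≢p ∘ sym)))

Nondecreasing : ∀ {n} → Vec ℕ n → Set
Nondecreasing {n} w = ∀ (i j : Fin n) → toℕ i ≤ toℕ j → lookup w i ≤ lookup w j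

HeadIsZero : ∀ {n} → Vec ℕ n → Set
HeadIsZero []      = ⊥
HeadIsZero (x ∷ _) = x ≡ 0

HeadIsZero-removeAt : ∀ {n} (w : Vec ℕ (suc n)) (p : Fin (suc n)) →
  HeadIsZero w → lookup w p ≡ 0 ⊎ HeadIsZero (removeAt w p)
HeadIsZero-removeAt (x ∷ xs)     Fin.zero    h = inj₁ h
HeadIsZero-removeAt (x ∷ y ∷ ys) (Fin.suc p) h = inj₂ h

-- Cell′ n is Cell (suc n): the dimension n is the length of w.
Cell′ : ℕ → Set
Cell′ n = Vec ℕ n × Vec (Fin n) n

IsSimplexCell : (n q : ℕ) → Cell′ n → Set
IsSimplexCell n q s = IsSimplex (suc n) q s

lookup-vertex : ∀ {n} (w : Vec ℕ n) (π : Vec (Fin n) n) (j : Fin (suc n)) (c : Fin n) →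
  lookup (vertex w π j) c ≡ lookup w c + indicator (c ∈? drop (n ∸ toℕ j) (toList π))
lookup-vertex w π j c = Vecₚ.lookup∘tabulate _ c

lookup-vertex-zero : ∀ {n} (w : Vec ℕ n) (π : Vec (Fin n) n) (c : Fin n) →
  lookup (vertex w π Fin.zero) c ≡ lookup w c
lookup-vertex-zero {n} w π c = begin
  lookup (vertex w π Fin.zero) c                   ≡⟨ lookup-vertex w π Fin.zero c ⟩
  lookup w c + indicator (c ∈? drop n (toList π))  ≡⟨ cong (λ cs → lookup w c + indicator (c ∈? cs)) (drop-toList π) ⟩
  lookup w c + 0                                   ≡⟨ ℕₚ.+-identityʳ _ ⟩
  lookup w c ∎
  where open ≡-Reasoning

∈-map-punchIn-∷ʳ⁻ : ∀ {n} (p : Fin (suc n)) (c : Fin n) (cs : List (Fin n)) →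
  punchIn p c ∈ List.map (punchIn p) cs ++ [ p ] → c ∈ cs
∈-map-punchIn-∷ʳ⁻ p c cs c∈ with ∈ₚ.∈-++⁻ (List.map (punchIn p) cs) c∈
... | inj₂ (here c≡p) = contradiction c≡p (Finₚ.punchInᵢ≢i p c)
... | inj₁ c∈map with ∈ₚ.∈-map⁻ (punchIn p) c∈map
...   | c′ , c′∈cs , c≡c′ = subst (_∈ cs) (sym (Finₚ.punchIn-injective p c c′ c≡c′)) c′∈cs

-- The inserted coordinate p is appended to π, so it is the first one raised:
-- vertex j + 1 of the new cell restricts to vertex j of the old one, and
-- vertex 1 is w + e_p.
insertCoordinate : ∀ {n} → Fin (suc n) → ℕ → Cell′ n → Cell′ (suc n)
insertCoordinate p v (w , π) = insertAt w p v , Vec.map (punchIn p) π ∷ʳ p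

lookup-vertex-suc-insertCoordinate : ∀ {n} (p : Fin (suc n)) (v : ℕ) (w : Vec ℕ n) (π : Vec (Fin n) n)
  (j : Fin (suc n)) (c : Fin n) →
  lookup (vertex (insertAt w p v) (Vec.map (punchIn p) π ∷ʳ p) (Fin.suc j)) (punchIn p c)
    ≡ lookup (vertex w π j) c
lookup-vertex-suc-insertCoordinate {n} p v w π j c = begin
  lookup (vertex W Π (Fin.suc j)) (punchIn p c)
    ≡⟨ lookup-vertex W Π (Fin.suc j) (punchIn p c) ⟩
  lookup W (punchIn p c) + indicator (punchIn p c ∈? drop m (toList Π))
    ≡⟨ cong₂ _+_ (Vecₚ.insertAt-punchIn w p v c) same-indicator ⟩
  lookup w c + indicator (c ∈? drop m (toList π))
    ≡⟨ lookup-vertex w π j c ⟨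
  lookup (vertex w π j) c ∎
  where
  open ≡-Reasoning
  W = insertAt w p v
  Π = Vec.map (punchIn p) π ∷ʳ p
  m = n ∸ toℕ j
  D = drop m (toList π)
  same-indicator : indicator (punchIn p c ∈? drop m (toList Π)) ≡ indicator (c ∈? D)
  same-indicator = begin
    indicator (punchIn p c ∈? drop m (toList Π))
      ≡⟨ cong (λ cs → indicator (punchIn p c ∈? cs)) (drop-toList-map-∷ʳ (punchIn p) p π m (ℕₚ.m∸n≤m n (toℕ j))) ⟩
    indicator (punchIn p c ∈? (List.map (punchIn p) D ++ [ p ]))
      ≡⟨ indicator-cong (punchIn p c ∈? (List.map (punchIn p) D ++ [ p ])) (c ∈? D) (∈-map-punchIn-∷ʳ⁻ p c D) (∈ₚ.∈-++⁺ˡ ∘ ∈ₚ.∈-map⁺ (punchIn p)) ⟩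
    indicator (c ∈? D) ∎

lookup-vertex-one : ∀ {n} (p : Fin (suc n)) (W : Vec ℕ (suc n)) (π : Vec (Fin n) n) (c : Fin (suc n)) →
  lookup (vertex W (Vec.map (punchIn p) π ∷ʳ p) (Fin.suc Fin.zero)) c ≡ lookup W c + indicator (c ∈? [ p ])
lookup-vertex-one {n} p W π c = begin
  lookup (vertex W Π (Fin.suc Fin.zero)) c              ≡⟨ lookup-vertex W Π (Fin.suc Fin.zero) c ⟩
  lookup W c + indicator (c ∈? drop n (toList Π))       ≡⟨ cong (λ cs → lookup W c + indicator (c ∈? cs)) last-only ⟩
  lookup W c + indicator (c ∈? [ p ]) ∎
  where
  open ≡-Reasoning
  Π = Vec.map (punchIn p) π ∷ʳ p
  last-only : drop n (toList Π) ≡ [ p ]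
  last-only = trans (drop-toList-map-∷ʳ (punchIn p) p π n ℕₚ.≤-refl)
                    (cong (λ cs → List.map (punchIn p) cs ++ [ p ]) (drop-toList π))

lookup-vertex-one-at : ∀ {n} (p : Fin (suc n)) (W : Vec ℕ (suc n)) (π : Vec (Fin n) n) →
  lookup (vertex W (Vec.map (punchIn p) π ∷ʳ p) (Fin.suc Fin.zero)) p ≡ suc (lookup W p)
lookup-vertex-one-at p W π =
  trans (lookup-vertex-one p W π p)
        (trans (cong (lookup W p +_) (indicator-yes (p ∈? [ p ]) (here refl))) (ℕₚ.+-comm (lookup W p) 1))

lookup-vertex-one-off : ∀ {n} (p : Fin (suc n)) (W : Vec ℕ (suc n)) (π : Vec (Fin n) n) (c : Fin (suc n)) →
  c ≢ p → lookup (vertex W (Vec.map (punchIn p) π ∷ʳ p) (Fin.suc Fin.zero)) c ≡ lookup W c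
lookup-vertex-one-off p W π c c≢p =
  trans (lookup-vertex-one p W π c)
        (trans (cong (lookup W c +_) (indicator-no (c ∈? [ p ]) λ { (here c≡p) → c≢p c≡p })) (ℕₚ.+-identityʳ _))

insertionIndex : ∀ {n} → ℕ → Vec ℕ n → Fin (suc n)
insertionIndex v []       = Fin.zero
insertionIndex v (x ∷ xs) with x ≤? v
... | yes _ = Fin.suc (insertionIndex v xs)
... | no  _ = Fin.zero

insertionIndex-unique : ∀ {n} (v : ℕ) (w : Vec ℕ n) (p : Fin (suc n)) →
  Nondecreasing (insertAt w p v) →
  (∀ c → toℕ c ≡ suc (toℕ p) → v < lookup (insertAt w p v) c) →
  insertionIndex v w ≡ p
insertionIndex-unique v []       Fin.zero    _    _      = refl
insertionIndex-unique v (x ∷ xs) Fin.zero    _    v<next with x ≤? v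
... | yes x≤v = contradiction x≤v (ℕₚ.<⇒≱ (v<next (Fin.suc Fin.zero) refl))
... | no  _   = refl
insertionIndex-unique v (x ∷ xs) (Fin.suc p) mono v<next with x ≤? v
... | yes _   = cong Fin.suc (insertionIndex-unique v xs p (λ i j i≤j → mono (Fin.suc i) (Fin.suc j) (s≤s i≤j))
                                                            (λ c c≡ → v<next (Fin.suc c) (cong suc c≡)))
... | no  x≰v = contradiction (subst (x ≤_) (Vecₚ.insertAt-lookup xs p v) (mono Fin.zero (Fin.suc p) z≤n)) x≰v

vertices-insertCoordinate⁻ : ∀ {n} q (p : Fin (suc n)) v (w : Vec ℕ n) (π : Vec (Fin n) n) →
  (∀ j → InR q (vertex (insertAt w p v) (Vec.map (punchIn p) π ∷ʳ p) j)) →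
  ∀ j → InR q (vertex w π j)
vertices-insertCoordinate⁻ q p v w π inR j =
    (λ i i′ i≤i′ → subst₂ _≤_ (same i) (same i′)
                     (proj₁ (inR (Fin.suc j)) (punchIn p i) (punchIn p i′) (Finₚ.punchIn-mono-≤ p i i′ i≤i′)))
  , (λ i → subst (_≤ q) (same i) (proj₂ (inR (Fin.suc j)) (punchIn p i)))
  where
  same = lookup-vertex-suc-insertCoordinate p v w π j

-- Vertex 1 of the new cell is w + e_p; it lies in R_{k,q}, so v + 1 ≤ q and
-- v + 1 is at most the entry following position p, which determines p.
isSimplexCell-insertCoordinate⁻ : ∀ {n} q (p : Fin (suc n)) v (w : Vec ℕ n) (π : Vec (Fin n) n) →
  IsSimplexCell (suc n) q (insertCoordinate p v (w , π)) →
  IsSimplexCell n q (w , π) × v < q × insertionIndex v w ≡ p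
isSimplexCell-insertCoordinate⁻ q p v w π (Π! , inR) =
  (Unique-map⁻ (punchIn p) π (proj₁ (Unique-∷ʳ⁻ _ p Π!)) , vertices-insertCoordinate⁻ q p v w π inR) ,
  v<q , insertionIndex-unique v w p nondecreasing v<next
  where
  W = insertAt w p v
  Π = Vec.map (punchIn p) π ∷ʳ p
  vertex₁-p : lookup (vertex W Π (Fin.suc Fin.zero)) p ≡ suc v
  vertex₁-p = trans (lookup-vertex-one-at p W π) (cong suc (Vecₚ.insertAt-lookup w p v))
  v<q : v < q
  v<q = subst (_≤ q) vertex₁-p (proj₂ (inR (Fin.suc Fin.zero)) p)
  nondecreasing : Nondecreasing W
  nondecreasing i j i≤j = subst₂ _≤_ (lookup-vertex-zero W Π i) (lookup-vertex-zero W Π j) (proj₁ (inR Fin.zero) i j i≤j)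
  v<next : ∀ c → toℕ c ≡ suc (toℕ p) → v < lookup W c
  v<next c c≡p+1 =
    subst (suc v ≤_) (lookup-vertex-one-off p W π c c≢p)
      (subst (_≤ lookup (vertex W Π (Fin.suc Fin.zero)) c) vertex₁-p (proj₁ (inR (Fin.suc Fin.zero)) p c (subst (toℕ p ≤_) (sym c≡p+1) (ℕₚ.n≤1+n _))))
    where
    c≢p : c ≢ p
    c≢p c≡p = ℕₚ.1+n≢n (sym (trans (cong toℕ (sym c≡p)) c≡p+1))

extendCell : ∀ {n} → Cell′ n → ℕ → Cell′ (suc n)
extendCell s v = insertCoordinate (insertionIndex v (proj₁ s)) v s

record Deletion (q : ℕ) {n : ℕ} (s : Cell′ (suc n)) : Set where
  constructor deletion
  field
    cell           : Cell′ n
    value          : ℕ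
    cell-isSimplex : IsSimplexCell n q cell
    value<q        : value < q
    extendCell≡    : extendCell cell value ≡ s
    headIsZero     : HeadIsZero (proj₁ s) → value ≡ 0 ⊎ HeadIsZero (proj₁ cell)

deleteLastCoordinate : ∀ {n} q (s : Cell′ (suc n)) → IsSimplexCell (suc n) q s → Deletion q s
deleteLastCoordinate q (w , π) s-simplex with initLast π
... | πs , p , refl with Unique-∷ʳ⁻ πs p (proj₁ s-simplex)
... | _ , πs≢p with All≢⇒map-punchIn p πs πs≢p
... | π′ , refl = record
  { cell           = removeAt w p , π′
  ; value          = lookup w p
  ; cell-isSimplex = proj₁ split
  ; value<q        = proj₁ (proj₂ split)
  ; extendCell≡    = trans (cong (λ i → insertCoordinate i (lookup w p) (removeAt w p , π′)) (proj₂ (proj₂ split)))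
                           (cong (_, _) (Vecₚ.insertAt-removeAt w p))
  ; headIsZero     = HeadIsZero-removeAt w p
  }
  where
  split = isSimplexCell-insertCoordinate⁻ q p (lookup w p) (removeAt w p) π′
            (subst (λ W → IsSimplexCell _ q (W , _)) (sym (Vecₚ.insertAt-removeAt w p)) s-simplex)

cells : ℕ → (n : ℕ) → List (Cell′ n)
cells q zero    = [ ([] , []) ]
cells q (suc n) = cartesianProductWith extendCell (cells q n) (upTo q)

headIsZeroCells : ℕ → (n : ℕ) → List (Cell′ n)
headIsZeroCells r zero    = []
headIsZeroCells r (suc n) =
  List.map (λ s → extendCell s 0) (cells (suc r) n) ++
  cartesianProductWith (λ s v → extendCell s (suc v)) (headIsZeroCells r n) (upTo r)

cells-complete : ∀ q n (s : Cell′ n) → IsSimplexCell n q s → s ∈ cells q n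
cells-complete q zero    ([] , []) _         = here refl
cells-complete q (suc n) s         s-simplex =
  subst (_∈ cells q (suc n)) extendCell≡
    (∈ₚ.∈-cartesianProductWith⁺ extendCell (cells-complete q n cell cell-isSimplex) (∈ₚ.∈-upTo⁺ value<q))
  where open Deletion (deleteLastCoordinate q s s-simplex)

headIsZeroCells-complete : ∀ r n (s : Cell′ n) → IsSimplexCell n (suc r) s → HeadIsZero (proj₁ s) →
  s ∈ headIsZeroCells r n
headIsZeroCells-complete r zero ([] , []) _ ()
headIsZeroCells-complete r (suc n) s s-simplex s₁≡0 with deleteLastCoordinate (suc r) s s-simplex
... | deletion cell zero cell-isSimplex _ refl _ =
  ∈ₚ.∈-++⁺ˡ (∈ₚ.∈-map⁺ (λ s → extendCell s 0) (cells-complete (suc r) n cell cell-isSimplex))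
... | deletion cell (suc v) cell-isSimplex (s≤s v<r) refl headIsZero with headIsZero s₁≡0
...   | inj₂ cell₁≡0 =
  ∈ₚ.∈-++⁺ʳ (List.map (λ s → extendCell s 0) (cells (suc r) n))
    (∈ₚ.∈-cartesianProductWith⁺ (λ s v → extendCell s (suc v))
      (headIsZeroCells-complete r n cell cell-isSimplex cell₁≡0) (∈ₚ.∈-upTo⁺ v<r))

length-cells : ∀ q n → length (cells q n) ≡ q ^ n
length-cells q zero    = refl
length-cells q (suc n) = begin
  length (cartesianProductWith extendCell (cells q n) (upTo q)) ≡⟨ length-cartesianProductWith extendCell (cells q n) (upTo q) ⟩
  length (cells q n) * length (upTo q)                         ≡⟨ cong₂ _*_ (length-cells q n) (Listₚ.length-upTo q) ⟩
  q ^ n * q                                                    ≡⟨ ℕₚ.*-comm (q ^ n) q ⟩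
  q ^ suc n ∎
  where open ≡-Reasoning

length-headIsZeroCells : ∀ r n → length (headIsZeroCells r n) + r ^ n ≡ suc r ^ n
length-headIsZeroCells r zero    = refl
length-headIsZeroCells r (suc n) = begin
  length (List.map (λ s → extendCell s 0) (cells (suc r) n) ++ extended) + r * r ^ n
    ≡⟨ cong (_+ r * r ^ n) (Listₚ.length-++ (List.map (λ s → extendCell s 0) (cells (suc r) n))) ⟩
  (length (List.map (λ s → extendCell s 0) (cells (suc r) n)) + length extended) + r * r ^ n
    ≡⟨ cong (λ x → (x + length extended) + r * r ^ n)
            (trans (Listₚ.length-map (λ s → extendCell s 0) (cells (suc r) n)) (length-cells (suc r) n)) ⟩
  (suc r ^ n + length extended) + r * r ^ n
    ≡⟨ cong (λ x → (suc r ^ n + x) + r * r ^ n)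
            (trans (length-cartesianProductWith _ (headIsZeroCells r n) (upTo r))
                   (trans (cong (length (headIsZeroCells r n) *_) (Listₚ.length-upTo r))
                          (ℕₚ.*-comm (length (headIsZeroCells r n)) r))) ⟩
  (suc r ^ n + r * length (headIsZeroCells r n)) + r * r ^ n
    ≡⟨ ℕₚ.+-assoc (suc r ^ n) _ _ ⟩
  suc r ^ n + (r * length (headIsZeroCells r n) + r * r ^ n)
    ≡⟨ cong (suc r ^ n +_) (ℕₚ.*-distribˡ-+ r (length (headIsZeroCells r n)) (r ^ n)) ⟨
  suc r ^ n + r * (length (headIsZeroCells r n) + r ^ n)
    ≡⟨ cong (λ x → suc r ^ n + r * x) (length-headIsZeroCells r n) ⟩
  suc r ^ n + r * suc r ^ n ∎
  where
  open ≡-Reasoning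
  extended = cartesianProductWith (λ s v → extendCell s (suc v)) (headIsZeroCells r n) (upTo r)

firstNonzero : ∀ {n} → Vec ℕ (suc n) → Fin (suc n)
firstNonzero (suc _ ∷ _)      = Fin.zero
firstNonzero (zero ∷ [])      = Fin.zero
firstNonzero (zero ∷ x ∷ xs)  = Fin.suc (firstNonzero (x ∷ xs))

firstNonzero-zero⇒sum≡0 : ∀ {n} (v : Vec ℕ (suc n)) (i : Fin (suc n)) →
  lookup v i ≡ 0 → firstNonzero v ≡ i → Vec.sum v ≡ 0
firstNonzero-zero⇒sum≡0 (zero ∷ [])     Fin.zero    _    _  = refl
firstNonzero-zero⇒sum≡0 (zero ∷ x ∷ xs) Fin.zero    _    ()
firstNonzero-zero⇒sum≡0 (zero ∷ x ∷ xs) (Fin.suc i) vᵢ≡0 eq =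
  firstNonzero-zero⇒sum≡0 (x ∷ xs) i vᵢ≡0 (Finₚ.suc-injective eq)

firstNonzero-sperner : ∀ n r → Sperner (suc n) (suc r) firstNonzero
firstNonzero-sperner n r v sum≡q i vᵢ≡0 eq = ℕₚ.0≢1+n (trans (sym (firstNonzero-zero⇒sum≡0 v i vᵢ≡0 eq)) sum≡q)

-- Every vertex of the cell has first coordinate at least suc a, so firstNonzero
-- computes to zero on each of them.
head-suc⇒monochromatic : ∀ {m} q a (ws : Vec ℕ m) (π : Vec (Fin (suc m)) (suc m)) →
  Monochromatic (suc (suc m)) q firstNonzero (suc a ∷ ws , π)
head-suc⇒monochromatic q a ws π _ _ = refl

theorem1p2 : ∀ (k q : ℕ) → 2 ≤ k → 1 ≤ q →
    Σ (Labeling k) λ c → Sperner k q c ×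
      Σ (List (Cell k)) λ L →
        length L ≤ q ^ (k ∸ 1) ∸ (q ∸ 1) ^ (k ∸ 1) ×
        (∀ (s : Cell k) → IsSimplex k q s → ¬ Monochromatic k q c s → s ∈ L)
theorem1p2 (suc (suc m)) (suc r) (s≤s (s≤s z≤n)) (s≤s z≤n) =
  firstNonzero , firstNonzero-sperner (suc m) r , headIsZeroCells r (suc m) , length≤ , covers
  where
  length≤ : length (headIsZeroCells r (suc m)) ≤ suc r ^ suc m ∸ r ^ suc m
  length≤ = ℕₚ.≤-reflexive (begin
    length (headIsZeroCells r (suc m))                                  ≡⟨ ℕₚ.m+n∸n≡m _ (r ^ suc m) ⟨
    length (headIsZeroCells r (suc m)) + r ^ suc m ∸ r ^ suc m          ≡⟨ cong (_∸ r ^ suc m) (length-headIsZeroCells r (suc m)) ⟩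
    suc r ^ suc m ∸ r ^ suc m ∎)
    where open ≡-Reasoning
  covers : ∀ s → IsSimplex (suc (suc m)) (suc r) s → ¬ Monochromatic (suc (suc m)) (suc r) firstNonzero s →
           s ∈ headIsZeroCells r (suc m)
  covers (zero ∷ ws , π)  s-simplex _  = headIsZeroCells-complete r (suc m) (zero ∷ ws , π) s-simplex refl
  covers (suc a ∷ ws , π) _ ¬mono     = ⊥-elim (¬mono (head-suc⇒monochromatic (suc r) a ws π))
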